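{- Let $n\ge1$ and let $T$ be a rooted tree on $[n]_0$. Then $\tau(\varphi_T)\setminus 11=\delta(T)$; that is, the multiset of lengths of the cycles of $\varphi_T$ other than the two fixed points $0$ and $n$ coincides with the multiset of distances $d_T(R,R')$ over all doubly record-covering pairs $R\lhd R'$ of $T$.
   Context: A rooted tree on $[n]_0$ is a labeled tree with vertex set $\{0,1,\dots,n\}$ rooted at $0$; the root $0$ is never a record, and a non-root node is a record if its label is the largest among the non-root nodes on its path to the root. Let $p_T$ be the parent function ($p_T(0)=0$). The record code $(r_1,\dots,r_{n-1})$ of $T$ is defined by $r_i=p_T(i)$ if $i$ is not a record and $r_i=p_T(i')$ if $i$ is a record, where $i'$ is the smallest record larger than $i$. Define $\varphi_T:\{0,\dots,n\}\to\{0,\dots,n\}$ by $\varphi_T(i)=r_i$ for $i\in[n-1]$, $\varphi_T(0)=0$, $\varphi_T(n)=n$. The type $\tau(\varphi)$ of an endofunction is the partition formed by the lengths of its cycles (a fixed point is a cycle of length $1$); for partitions $\alpha=1^{m_1}2^{m_2}\cdots$ and $\beta=1^{m_1'}2^{m_2'}\cdots$ with $m_i\ge m_i'$, $\alpha\setminus\beta=1^{m_1-m_1'}2^{m_2-m_2'}\cdots$, and $11$ denotes the partition $1^2$. Two records $R,R'$ of $T$ form a doubly record-covering pair, $R\lhd R'$, if $R$ is a proper ancestor of $R'$, $R<R'$, and no record $R''$ satisfies $R<R''<R'$. $d_T(a,b)$ is the number of edges on the path between $a$ and $b$. The distance partition $\delta(T)$ is the partition whose parts are the $d_T(R,R')$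 over all doubly record-covering pairs. -}

module Defs where

open import Data.Nat using (ℕ; zero; suc; _≤_)
open import Data.Fin using (Fin; fromℕ) renaming (zero to fzero; _<_ to _<ᶠ_; _≤_ to _≤ᶠ_)
open import Data.Product using (Σ; ∃; _×_; _,_; proj₂)
open import Data.List using (List; map)
open import Data.List.Membership.Propositional using (_∈_)
open import Data.List.Relation.Unary.Unique.Propositional using (Unique)
open import Relation.Binary.PropositionalEquality using (_≡_; _≢_)
open import Relation.Nullary using (¬_)
open import Function.Bundles using (_⇔_)

iter : {A : Set} → (A → A) → ℕ → A → A
iter f zero    x = x
iter f (suc k) x = f (iter f k x)

-- Vertex set [n]_0 = {0,...,n} is Fin (suc n); a rooted tree on [n]_0 is given
-- by its parent function p (with p 0 = 0), such that every vertex reaches the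
-- root 0 by iterating p.
IsRootedTree : (n : ℕ) → (Fin (suc n) → Fin (suc n)) → Set
IsRootedTree n p = (p fzero ≡ fzero) × (∀ i → ∃ λ k → iter p k i ≡ fzero)

module _ {n : ℕ} (p : Fin (suc n) → Fin (suc n)) where

  IsRecord : Fin (suc n) → Set
  IsRecord i = (i ≢ fzero) × (∀ k → iter p k i ≢ fzero → iter p k i ≤ᶠ i)

  ProperAncestor : Fin (suc n) → Fin (suc n) → Set
  ProperAncestor a b = (a ≢ b) × (∃ λ k → iter p k b ≡ a)

  SmallestRecordAbove : Fin (suc n) → Fin (suc n) → Set
  SmallestRecordAbove i j =
    IsRecord j × (i <ᶠ j) × (∀ k → IsRecord k → i <ᶠ k → j ≤ᶠ k)

  IsPhi : (Fin (suc n) → Fin (suc n)) → Set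
  IsPhi φ =
    (φ fzero ≡ fzero) × (φ (fromℕ n) ≡ fromℕ n) ×
    (∀ i → i ≢ fzero → i ≢ fromℕ n →
       (¬ IsRecord i → φ i ≡ p i) ×
       (IsRecord i → ∀ i′ → SmallestRecordAbove i i′ → φ i ≡ p i′))

  DRC : Fin (suc n) → Fin (suc n) → Set
  DRC R R′ = IsRecord R × IsRecord R′ × ProperAncestor R R′ × (R <ᶠ R′) ×
             (∀ R″ → IsRecord R″ → ¬ ((R <ᶠ R″) × (R″ <ᶠ R′)))

  IsAncestorDistance : Fin (suc n) → Fin (suc n) → ℕ → Set
  IsAncestorDistance a b d = iter p d b ≡ a

module _ {n : ℕ} (φ : Fin (suc n) → Fin (suc n)) where

  IsCyclic : Fin (suc n) → Set
  IsCyclic x = ∃ λ k → (1 ≤ k) × (iter φ k x ≡ x)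

  IsCycleRep : Fin (suc n) → Set
  IsCycleRep x = IsCyclic x × (∀ k → x ≤ᶠ iter φ k x)

  IsCycleLength : Fin (suc n) → ℕ → Set
  IsCycleLength x ℓ = (1 ≤ ℓ) × (iter φ ℓ x ≡ x) ×
                      (∀ k → 1 ≤ k → iter φ k x ≡ x → ℓ ≤ k)

Enumerates : {A : Set} → List A → (A → Set) → Set
Enumerates xs P = Unique xs × (∀ x → (x ∈ xs) ⇔ P x)

{-# OPTIONS --safe #-}
module Submission where

-- φ agrees with the parent map p except at records: a record R < n jumps to the parent of R′,
-- the next larger record.  If R ◁ R′ at distance d, no node strictly between R′ and R on their
-- path is a record, so φ walks R ↦ p R′ ↦ p² R′ ↦ ⋯ ↦ pᵈ R′ = R, a cycle of length d whose only
-- record is R.  Conversely, a cycle of φ other than {0} and {n} contains a record R, since a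
-- cycle avoiding records would be a cycle of p.  The largest label on the path to the root
-- never increases under φ; going once around the cycle, this forces the largest proper
-- ancestor of R′ to be R itself, so R ◁ R′.  Hence R ◁ R′ ↦ (cycle through R) is a
-- length-preserving bijection.

open import Defs
open import Data.Nat using (ℕ; zero; suc; _+_; _*_; _∸_; _≤_; _<_; z≤n; s≤s; _<?_; >-nonZero)
open import Data.Nat.Properties
  using ( +-comm; ≤-refl; ≤-antisym; <-≤-trans; <⇒≤; <⇒≢; <⇒≱; ≮⇒≥; n≮0; n≢0⇒n>0; n≤0⇒n≡0
        ; m≤m*n; m∸n+n≡m; m<n⇒0<n∸m)
open import Data.Nat.DivMod using (_%_; _/_; m≡m%n+[m/n]*n; m%n<n)
open import Data.Fin using (Fin; toℕ; fromℕ)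
  renaming (zero to fzero; _<_ to _<ᶠ_; _≤_ to _≤ᶠ_)
import Data.Fin.Properties as Finₚ
open import Data.Product using (∃; _×_; _,_; proj₁; proj₂)
open import Data.Sum using (_⊎_; inj₁; inj₂)
open import Data.Empty using (⊥-elim)
open import Data.List using (List; map; upTo; filter; allFin)
open import Data.List.Properties using (map-∘)
open import Data.List.Membership.Propositional using (_∈_; find; lose)
open import Data.List.Membership.Propositional.Properties
  using (∈-upTo⁺; ∈-allFin; ∈-filter⁺; ∈-filter⁻; ∈-map⁺; ∈-map⁻)
open import Data.List.Membership.Propositional.Properties.WithK using (unique∧set⇒bag)
open import Data.List.Relation.Unary.All as All using (All; []; _∷_)
import Data.List.Relation.Unary.All.Properties as Allₚ
open import Data.List.Relation.Unary.Any using (any?)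
open import Data.List.Relation.Unary.Unique.Propositional using (Unique)
import Data.List.Relation.Unary.AllPairs as AllPairs
open import Data.List.Relation.Binary.BagAndSetEquality using (∼bag⇒↭)
open import Data.List.Relation.Binary.Permutation.Propositional
  using (_↭_; ↭-trans; ↭-reflexive)
open import Data.List.Relation.Binary.Permutation.Propositional.Properties using (map⁺)
open import Function using (id; _∘_; _⇔_; mk⇔; Equivalence)
open import Relation.Binary.PropositionalEquality
  using (_≡_; _≢_; refl; sym; trans; cong; cong₂; subst; module ≡-Reasoning)
open import Relation.Nullary using (¬_; yes; no; _×-dec_)
open import Relation.Unary using (Pred; Decidable)
open import Level using (0ℓ)
open ≡-Reasoning

module _ {A : Set} (f : A → A) where

  iter-+ : ∀ a b x → iter f (a + b) x ≡ iter f a (iter f b x)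
  iter-+ zero    b x = refl
  iter-+ (suc a) b x = cong f (iter-+ a b x)

  iter-comm : ∀ a b x → iter f a (iter f b x) ≡ iter f b (iter f a x)
  iter-comm a b x = begin
    iter f a (iter f b x)  ≡⟨ iter-+ a b x ⟨
    iter f (a + b) x       ≡⟨ cong (λ k → iter f k x) (+-comm a b) ⟩
    iter f (b + a) x       ≡⟨ iter-+ b a x ⟩
    iter f b (iter f a x)  ∎

  iter-sucʳ : ∀ k x → iter f (suc k) x ≡ iter f k (f x)
  iter-sucʳ k = iter-comm 1 k

  iter-∸ : ∀ {j d} x → j ≤ d → iter f (d ∸ j) (iter f j x) ≡ iter f d x
  iter-∸ {j} {d} x j≤d = begin
    iter f (d ∸ j) (iter f j x)  ≡⟨ iter-+ (d ∸ j) j x ⟨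
    iter f (d ∸ j + j) x         ≡⟨ cong (λ k → iter f k x) (m∸n+n≡m j≤d) ⟩
    iter f d x                   ∎

  iter-fixed : ∀ {x} → f x ≡ x → ∀ k → iter f k x ≡ x
  iter-fixed fx≡x zero    = refl
  iter-fixed fx≡x (suc k) = trans (cong f (iter-fixed fx≡x k)) fx≡x

  iter-periodic : ∀ {d y} → iter f d y ≡ y → ∀ t → iter f (t * d) y ≡ y
  iter-periodic per zero = refl
  iter-periodic {d} {y} per (suc t) = begin
    iter f (d + t * d) y         ≡⟨ iter-+ d (t * d) y ⟩
    iter f d (iter f (t * d) y)  ≡⟨ cong (iter f d) (iter-periodic per t) ⟩
    iter f d y                   ≡⟨ per ⟩
    y                            ∎

  module Periodic {d y} (d≥1 : 1 ≤ d) (per : iter f d y ≡ y) where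

    private instance
      d≢0 = >-nonZero d≥1

    iter-% : ∀ k → iter f k y ≡ iter f (k % d) y
    iter-% k = begin
      iter f k y                             ≡⟨ cong (λ m → iter f m y) (m≡m%n+[m/n]*n k d) ⟩
      iter f (k % d + k / d * d) y           ≡⟨ iter-+ (k % d) (k / d * d) y ⟩
      iter f (k % d) (iter f (k / d * d) y)  ≡⟨ cong (iter f (k % d)) (iter-periodic per (k / d)) ⟩
      iter f (k % d) y                       ∎

    period-iter : ∀ k → iter f d (iter f k y) ≡ iter f k y
    period-iter k = trans (iter-comm d k y) (cong (iter f k) per)

    return : ∀ k → ∃ λ m → iter f m (iter f k y) ≡ y
    return k = k * d ∸ k , (begin
      iter f (k * d ∸ k) (iter f k y)  ≡⟨ iter-∸ y (m≤m*n k d) ⟩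
      iter f (k * d) y                 ≡⟨ iter-periodic per k ⟩
      y                                ∎)

    reaches-fixed : ∀ {x} k → f x ≡ x → iter f k y ≡ x → y ≡ x
    reaches-fixed {x} k fx≡x y⇝x = let m , ret = return k in begin
      y                      ≡⟨ ret ⟨
      iter f m (iter f k y)  ≡⟨ cong (iter f m) y⇝x ⟩
      iter f m x             ≡⟨ iter-fixed fx≡x m ⟩
      x                      ∎

∃-least : ∀ {m} {P : Pred (Fin m) 0ℓ} → Decidable P → ∀ {x} → P x →
          ∃ λ y → P y × (∀ z → P z → y ≤ᶠ z)
∃-least {m} {P} P? {x} px = min x xs , P-min (argmin-sel id x xs) , λ z pz →
  All.lookup (min≤xs x xs) (∈-filter⁺ P? (∈-allFin z) pz)
  where
  open import Data.List.Extrema (Finₚ.≤-totalOrder m) using (min; argmin-sel; min≤xs)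
  xs = filter P? (allFin m)
  P-min : (min x xs ≡ x) ⊎ (min x xs ∈ xs) → P (min x xs)
  P-min (inj₁ min≡x)  = subst P (sym min≡x) px
  P-min (inj₂ min∈xs) = proj₂ (∈-filter⁻ P? {xs = allFin m} min∈xs)

module _ {n : ℕ} (f : Fin (suc n) → Fin (suc n)) where

  cycleLength-intro : ∀ {d y} → 1 ≤ d → iter f d y ≡ y →
                      (∀ m → 1 ≤ m → m < d → iter f m y ≢ y) → IsCycleLength f y d
  cycleLength-intro d≥1 per aperiodic =
    d≥1 , per , λ m m≥1 perₘ → ≮⇒≥ (λ m<d → aperiodic m m≥1 m<d perₘ)

  cycleLength-unique : ∀ {x ℓ ℓ′} → IsCycleLength f x ℓ → IsCycleLength f x ℓ′ → ℓ ≡ ℓ′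
  cycleLength-unique (ℓ≥1 , per , least) (ℓ′≥1 , per′ , least′) =
    ≤-antisym (least _ ℓ′≥1 per′) (least′ _ ℓ≥1 per)

  cycleLength-iter : ∀ {y d} → IsCycleLength f y d → ∀ k → IsCycleLength f (iter f k y) d
  cycleLength-iter {y} {d} (d≥1 , per , least) k = d≥1 , period-iter k , least′
    where
    open Periodic f d≥1 per
    least′ : ∀ m → 1 ≤ m → iter f m (iter f k y) ≡ iter f k y → d ≤ m
    least′ m m≥1 perₘ = let r , ret = return k in least m m≥1 (begin
      iter f m y                        ≡⟨ cong (iter f m) ret ⟨
      iter f m (iter f r (iter f k y))  ≡⟨ iter-comm f m r _ ⟩
      iter f r (iter f m (iter f k y))  ≡⟨ cong (iter f r) perₘ ⟩
      iter f r (iter f k y)             ≡⟨ ret ⟩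
      y                                 ∎)

  open import Data.List.Extrema (Finₚ.≤-totalOrder (suc n)) using (argmin; f[argmin]≤f[xs])

  cycleMinIndex : Fin (suc n) → ℕ → ℕ
  cycleMinIndex y d = argmin (λ k → iter f k y) 0 (upTo d)

  cycleMin : Fin (suc n) → ℕ → Fin (suc n)
  cycleMin y d = iter f (cycleMinIndex y d) y

  module _ {y d} (d≥1 : 1 ≤ d) (per : iter f d y ≡ y) where
    open Periodic f d≥1 per

    cycleMin≤iter : ∀ k → cycleMin y d ≤ᶠ iter f k y
    cycleMin≤iter k = subst (cycleMin y d ≤ᶠ_) (sym (iter-% k))
      (All.lookup (f[argmin]≤f[xs] {f = λ k → iter f k y} 0 (upTo d)) (∈-upTo⁺ (m%n<n k d)))
      where instance _ = >-nonZero d≥1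

    cycleMin-isCycleRep : IsCycleRep f (cycleMin y d)
    cycleMin-isCycleRep = (d , d≥1 , period-iter i) , λ k →
      subst (cycleMin y d ≤ᶠ_) (iter-+ f k i y) (cycleMin≤iter (k + i))
      where i = cycleMinIndex y d

    cycleMin-return : ∃ λ r → iter f r (cycleMin y d) ≡ y
    cycleMin-return = return (cycleMinIndex y d)

  cycleRep-unique : ∀ {x x′} k → IsCycleRep f x → IsCycleRep f x′ → iter f k x ≡ x′ → x ≡ x′
  cycleRep-unique {x} {x′} k ((c , c≥1 , per) , x≤) (_ , x′≤) x⇝x′ =
    Finₚ.≤-antisym (subst (x ≤ᶠ_) x⇝x′ (x≤ k)) (subst (x′ ≤ᶠ_) x′⇝x (x′≤ r))
    where
    r = proj₁ (Periodic.return f c≥1 per k)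
    x′⇝x : iter f r x′ ≡ x
    x′⇝x = trans (cong (iter f r) (sym x⇝x′)) (proj₂ (Periodic.return f c≥1 per k))

unique-map⁺ : ∀ {A B : Set} {Q : B → Set} {h : B → A} →
              (∀ {b b′} → Q b → Q b′ → h b ≡ h b′ → b ≡ b′) →
              ∀ {ys} → All Q ys → Unique ys → Unique (map h ys)
unique-map⁺ h-injective [] AllPairs.[] = AllPairs.[]
unique-map⁺ h-injective (qy ∷ qys) (y∉ys AllPairs.∷ ys!) =
  Allₚ.map⁺ (All.zipWith (λ (qy′ , y≢y′) → y≢y′ ∘ h-injective qy qy′) (qys , y∉ys))
  AllPairs.∷ unique-map⁺ h-injective qys ys!

module _ {A B : Set} {P : A → Set} {Q : B → Set} (h : B → A)
         (h-into : ∀ b → Q b → P (h b))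
         (h-onto : ∀ a → P a → ∃ λ b → Q b × h b ≡ a)
         (h-injective : ∀ b b′ → Q b → Q b′ → h b ≡ h b′ → b ≡ b′) where

  enumerations-↭ : ∀ {xs ys} → Enumerates xs P → Enumerates ys Q → xs ↭ map h ys
  enumerations-↭ {xs} {ys} (xs! , xs∈) (ys! , ys∈) = ∼bag⇒↭ (unique∧set⇒bag xs! hys! same)
    where
    hys! : Unique (map h ys)
    hys! = unique-map⁺ (h-injective _ _) (All.tabulate (Equivalence.to (ys∈ _))) ys!

    same : ∀ {a} → a ∈ xs ⇔ a ∈ map h ys
    same {a} = mk⇔ to from
      where
      to : a ∈ xs → a ∈ map h ys
      to a∈xs = let b , qb , hb≡a = h-onto a (Equivalence.to (xs∈ a) a∈xs) in
        subst (_∈ map h ys) hb≡a (∈-map⁺ h (Equivalence.from (ys∈ b) qb))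
      from : a ∈ map h ys → a ∈ xs
      from a∈hys = let b , b∈ys , a≡hb = ∈-map⁻ h a∈hys in
        Equivalence.from (xs∈ a) (subst P (sym a≡hb) (h-into b (Equivalence.to (ys∈ b) b∈ys)))

module RootedTree {n : ℕ} (p : Fin (suc n) → Fin (suc n)) (tree : IsRootedTree n p) where

  iter-root : ∀ k → iter p k fzero ≡ fzero
  iter-root = iter-fixed p (proj₁ tree)

  iter-pastDepth : ∀ {K z m} → iter p K z ≡ fzero → K ≤ m → iter p m z ≡ fzero
  iter-pastDepth {K} {z} {m} atRoot K≤m = begin
    iter p m z                   ≡⟨ iter-∸ p z K≤m ⟨
    iter p (m ∸ K) (iter p K z)  ≡⟨ cong (iter p (m ∸ K)) atRoot ⟩
    iter p (m ∸ K) fzero         ≡⟨ iter-root (m ∸ K) ⟩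
    fzero                        ∎

  acyclic : ∀ {a z} → 1 ≤ a → iter p a z ≡ z → z ≡ fzero
  acyclic {a} {z} a≥1 per = let K , atRoot = proj₂ tree z in
    trans (sym (iter-periodic p per K)) (iter-pastDepth atRoot (m≤m*n K a))
    where instance _ = >-nonZero a≥1

  PathBelow : Fin (suc n) → Fin (suc n) → Set
  PathBelow b z = ∀ k → iter p k z ≤ᶠ b

  PathBelow-iter : ∀ {b z} → PathBelow b z → ∀ j → PathBelow b (iter p j z)
  PathBelow-iter {b} {z} below j k = subst (_≤ᶠ b) (iter-+ p k j z) (below (k + j))

  pathMax : ∀ a → ∃ λ j → PathBelow (iter p j a) a
  pathMax a = j , below
    where
    open import Data.List.Extrema (Finₚ.≤-totalOrder (suc n)) using (argmax; f[xs]≤f[argmax])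
    K = proj₁ (proj₂ tree a)
    j = argmax (λ k → iter p k a) 0 (upTo K)
    below : PathBelow (iter p j a) a
    below k with k <? K
    ... | yes k<K = All.lookup (f[xs]≤f[argmax] {f = λ k → iter p k a} 0 (upTo K)) (∈-upTo⁺ k<K)
    ... | no k≮K  = subst (_≤ᶠ iter p j a)
                      (sym (iter-pastDepth (proj₂ (proj₂ tree a)) (≮⇒≥ k≮K))) z≤n

  record⇒PathBelow : ∀ {z} → IsRecord p z → PathBelow z z
  record⇒PathBelow {z} (_ , maximal) k with iter p k z Finₚ.≟ fzero
  ... | yes atRoot = subst (_≤ᶠ z) (sym atRoot) z≤n
  ... | no notRoot = maximal k notRoot

  PathBelow⇒record : ∀ {z} → z ≢ fzero → PathBelow z z → IsRecord p z
  PathBelow⇒record z≢0 below = z≢0 , λ k _ → below k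

  isRecord? : Decidable (IsRecord p)
  isRecord? z with z Finₚ.≟ fzero | pathMax z
  ... | yes z≡0 | _ = no (λ rz → proj₁ rz z≡0)
  ... | no z≢0 | j , below with iter p j z Finₚ.≤? z
  ...   | yes max≤z = yes (PathBelow⇒record z≢0 (λ k → Finₚ.≤-trans (below k) max≤z))
  ...   | no max≰z  = no (λ rz → max≰z (record⇒PathBelow rz j))

  record-strict : ∀ {y} j → IsRecord p y → 1 ≤ j → iter p j y ≢ fzero → iter p j y <ᶠ y
  record-strict j (y≢0 , maximal) j≥1 notRoot =
    Finₚ.≤∧≢⇒< (maximal j notRoot) (λ eq → y≢0 (acyclic j≥1 eq))

  recordAbove : ∀ {a} → a ≢ fzero → ∃ λ j → IsRecord p (iter p j a) × a ≤ᶠ iter p j a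
  recordAbove {a} a≢0 = j , PathBelow⇒record M≢0 (PathBelow-iter below j) , below 0
    where
    j = proj₁ (pathMax a)
    below = proj₂ (pathMax a)
    M≢0 : iter p j a ≢ fzero
    M≢0 M≡0 = a≢0 (Finₚ.toℕ-injective (n≤0⇒n≡0 (subst (a ≤ᶠ_) M≡0 (below 0))))

  nextRecord : ∀ {z r} → IsRecord p r → z <ᶠ r → ∃ (SmallestRecordAbove p z)
  nextRecord {z} rr z<r =
    let y , (ry , z<y) , least = ∃-least (λ y → isRecord? y ×-dec z Finₚ.<? y) (rr , z<r) in
    y , ry , z<y , λ k rk z<k → least k (rk , z<k)

  nextRecord-unique : ∀ {z a b} → SmallestRecordAbove p z a → SmallestRecordAbove p z b → a ≡ b
  nextRecord-unique (ra , z<a , least-a) (rb , z<b , least-b) =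
    Finₚ.≤-antisym (least-a _ rb z<b) (least-b _ ra z<a)

  -- An ancestor a of z′ with z < a would lie below a record (the maximum of the path from a)
  -- strictly between z and z′.
  nextRecord-parentBelow : ∀ {z z′} → SmallestRecordAbove p z z′ → PathBelow z (p z′)
  nextRecord-parentBelow {z} {z′} (rz′ , _ , least) k = ≮⇒≥ z≮a
    where
    a = iter p k (p z′)
    z≮a : ¬ (z <ᶠ a)
    z≮a z<a with recordAbove (λ a≡0 → n≮0 (subst (z <ᶠ_) a≡0 z<a))
    ... | j , rM , a≤M = <⇒≱ M<z′ (least _ rM (<-≤-trans z<a a≤M))
      where
      M≡ : iter p (suc (j + k)) z′ ≡ iter p j a
      M≡ = trans (iter-sucʳ p (j + k) z′) (iter-+ p j k (p z′))
      M<z′ : iter p j a <ᶠ z′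
      M<z′ = subst (_<ᶠ z′) M≡
        (record-strict (suc (j + k)) rz′ (s≤s z≤n) (λ atRoot → proj₁ rM (trans (sym M≡) atRoot)))

module RecordCode {n : ℕ} (n≥1 : 1 ≤ n) (p : Fin (suc n) → Fin (suc n)) (tree : IsRootedTree n p)
                  (φ : Fin (suc n) → Fin (suc n)) (isφ : IsPhi p φ) where

  open RootedTree p tree

  top : Fin (suc n)
  top = fromℕ n

  top-isRecord : IsRecord p top
  top-isRecord = PathBelow⇒record top≢0 (λ k → Finₚ.≤fromℕ _)
    where
    top≢0 : top ≢ fzero
    top≢0 top≡0 = <⇒≢ n≥1 (trans (sym (cong toℕ top≡0)) (Finₚ.toℕ-fromℕ n))

  below-top : ∀ {z} → z ≢ top → z <ᶠ top
  below-top {z} z≢top = Finₚ.≤∧≢⇒< (Finₚ.≤fromℕ z) z≢top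

  φ-root : φ fzero ≡ fzero
  φ-root = proj₁ isφ

  φ-top : φ top ≡ top
  φ-top = proj₁ (proj₂ isφ)

  φ-nonRecord : ∀ {z} → ¬ IsRecord p z → φ z ≡ p z
  φ-nonRecord {z} ¬rz with z Finₚ.≟ fzero | z Finₚ.≟ top
  ... | yes refl | _      = trans φ-root (sym (proj₁ tree))
  ... | no _ | yes refl   = ⊥-elim (¬rz top-isRecord)
  ... | no z≢0 | no z≢top = proj₁ (proj₂ (proj₂ isφ) z z≢0 z≢top) ¬rz

  φ-record : ∀ {z z′} → IsRecord p z → z ≢ top → SmallestRecordAbove p z z′ → φ z ≡ p z′
  φ-record {z} rz z≢top next = proj₂ (proj₂ (proj₂ isφ) z (proj₁ rz) z≢top) rz _ next

  PathBelow-φ : ∀ {b z} → PathBelow b z → PathBelow b (φ z)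
  PathBelow-φ {b} {z} below with isRecord? z | z Finₚ.≟ top
  ... | no ¬rz | _        = subst (PathBelow b) (sym (φ-nonRecord ¬rz)) (PathBelow-iter below 1)
  ... | yes _ | yes refl  = subst (PathBelow b) (sym φ-top) below
  ... | yes rz | no z≢top =
    let z′ , next = nextRecord top-isRecord (below-top z≢top) in
    subst (PathBelow b) (sym (φ-record rz z≢top next))
      (λ k → Finₚ.≤-trans (nextRecord-parentBelow next k) (below 0))

  PathBelow-iterφ : ∀ {b z} → PathBelow b z → ∀ m → PathBelow b (iter φ m z)
  PathBelow-iterφ below zero    = below
  PathBelow-iterφ below (suc m) = PathBelow-φ (PathBelow-iterφ below m)

  φ-followsPath : ∀ {z w d} → φ z ≡ p w →
                  (∀ i → 1 ≤ i → i < d → ¬ IsRecord p (iter p i w)) →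
                  ∀ j → 1 ≤ j → j ≤ d → iter φ j z ≡ iter p j w
  φ-followsPath first nonRecord (suc zero) _ _ = first
  φ-followsPath {z} {w} first nonRecord (suc (suc j)) _ j<d = begin
    φ (iter φ (suc j) z)  ≡⟨ cong φ (φ-followsPath first nonRecord (suc j) (s≤s z≤n) (<⇒≤ j<d)) ⟩
    φ (iter p (suc j) w)  ≡⟨ φ-nonRecord (nonRecord (suc j) (s≤s z≤n) j<d) ⟩
    p (iter p (suc j) w)  ∎

  record CoveringCycle (R R′ : Fin (suc n)) (d : ℕ) : Set where
    field
      next       : SmallestRecordAbove p R R′
      R≢top      : R ≢ top
      length     : IsCycleLength φ R d
      onlyRecord : ∀ k → IsRecord p (iter φ k R) → iter φ k R ≡ R

  covering⇒cycle : ∀ {R R′} d → DRC p R R′ → IsAncestorDistance p R R′ d → CoveringCycle R R′ d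
  covering⇒cycle {R} {R′} d (rR , rR′ , (R≢R′ , _) , R<R′ , covering) dist = record
    { next = next ; R≢top = R≢top ; length = length ; onlyRecord = onlyRecord }
    where
    next : SmallestRecordAbove p R R′
    next = rR′ , R<R′ , λ k rk R<k → ≮⇒≥ (λ k<R′ → covering k rk (R<k , k<R′))

    R≢top : R ≢ top
    R≢top R≡top = <⇒≱ R<R′ (subst (R′ ≤ᶠ_) (sym R≡top) (Finₚ.≤fromℕ R′))

    d≥1 : 1 ≤ d
    d≥1 = n≢0⇒n>0 (λ { refl → R≢R′ (sym dist) })

    between : ∀ i → 1 ≤ i → i < d → ¬ IsRecord p (iter p i R′)
    between i i≥1 i<d ry = covering (iter p i R′) ry (R<y , y<R′)
      where
      y⇝R : iter p (d ∸ i) (iter p i R′) ≡ R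
      y⇝R = trans (iter-∸ p R′ (<⇒≤ i<d)) dist
      R<y = subst (_<ᶠ iter p i R′) y⇝R (record-strict (d ∸ i) ry (m<n⇒0<n∸m i<d)
              (λ atRoot → proj₁ rR (trans (sym y⇝R) atRoot)))
      y<R′ = record-strict i rR′ i≥1 (proj₁ ry)

    follows : ∀ j → 1 ≤ j → j ≤ d → iter φ j R ≡ iter p j R′
    follows = φ-followsPath (φ-record rR R≢top next) between

    length : IsCycleLength φ R d
    length = cycleLength-intro φ d≥1 (trans (follows d d≥1 ≤-refl) dist) aperiodic
      where
      aperiodic : ∀ m → 1 ≤ m → m < d → iter φ m R ≢ R
      aperiodic m m≥1 m<d perₘ = proj₁ rR (acyclic (m<n⇒0<n∸m m<d) (begin
        iter p (d ∸ m) R              ≡⟨ cong (iter p (d ∸ m)) R≡ ⟩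
        iter p (d ∸ m) (iter p m R′)  ≡⟨ iter-∸ p R′ (<⇒≤ m<d) ⟩
        iter p d R′                   ≡⟨ dist ⟩
        R                             ∎))
        where
        R≡ : R ≡ iter p m R′
        R≡ = trans (sym perₘ) (follows m m≥1 (<⇒≤ m<d))

    onlyRecord : ∀ k → IsRecord p (iter φ k R) → iter φ k R ≡ R
    onlyRecord k r =
      trans (iter-% k) (reduced (k % d) (m%n<n k d) (subst (IsRecord p) (iter-% k) r))
      where
      open Periodic φ d≥1 (proj₁ (proj₂ length))
      instance _ = >-nonZero d≥1
      reduced : ∀ j → j < d → IsRecord p (iter φ j R) → iter φ j R ≡ R
      reduced zero    _   _ = refl
      reduced (suc j) j<d r = ⊥-elim (between (suc j) (s≤s z≤n) j<d
        (subst (IsRecord p) (follows (suc j) (s≤s z≤n) (<⇒≤ j<d)) r))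

  recordOnCycle : ∀ {x ℓ} → 1 ≤ ℓ → iter φ ℓ x ≡ x → x ≢ fzero →
                  ∃ λ j → IsRecord p (iter φ j x)
  recordOnCycle {x} {ℓ} ℓ≥1 per x≢0 with any? (λ j → isRecord? (iter φ j x)) (upTo ℓ)
  ... | yes found = let j , _ , rj = find found in j , rj
  ... | no none   = ⊥-elim (x≢0 (acyclic ℓ≥1 (trans (sym (followsTree ℓ ≤-refl)) per)))
    where
    followsTree : ∀ j → j ≤ ℓ → iter φ j x ≡ iter p j x
    followsTree zero    _   = refl
    followsTree (suc j) j<ℓ = trans (φ-nonRecord (none ∘ lose (∈-upTo⁺ j<ℓ)))
                                    (cong p (followsTree j (<⇒≤ j<ℓ)))

  periodicRecord⇒covering : ∀ {R ℓ} → IsRecord p R → R ≢ top → 1 ≤ ℓ → iter φ ℓ R ≡ R →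
                            ∃ λ R′ → ∃ λ d → DRC p R R′ × IsAncestorDistance p R R′ d
  periodicRecord⇒covering {R} {ℓ} rR R≢top ℓ≥1 per = R′ , d , drc , M≡R
    where
    R′ = proj₁ (nextRecord top-isRecord (below-top R≢top))
    next = proj₂ (nextRecord top-isRecord (below-top R≢top))
    j = proj₁ (pathMax (p R′))
    d = suc j
    M = iter p d R′

    M-max : PathBelow M (p R′)
    M-max = subst (λ b → PathBelow b (p R′)) (sym (iter-sucʳ p j R′)) (proj₂ (pathMax (p R′)))

    M-dominates : PathBelow M M
    M-dominates = subst (PathBelow M) (sym (iter-sucʳ p j R′)) (PathBelow-iter M-max j)

    between : ∀ i → 1 ≤ i → i < d → ¬ IsRecord p (iter p i R′)
    between (suc i) _ i<d ry =
      proj₁ ry (acyclic (m<n⇒0<n∸m i<d) (trans (iter-∸ p _ (<⇒≤ i<d)) (sym y≡M)))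
      where
      y≡M : iter p (suc i) R′ ≡ M
      y≡M = Finₚ.≤-antisym
        (subst (_≤ᶠ M) (sym (iter-sucʳ p i R′)) (M-max i))
        (subst (_≤ᶠ iter p (suc i) R′) (iter-∸ p R′ (<⇒≤ i<d)) (record⇒PathBelow ry (d ∸ suc i)))

    reachesM : iter φ d R ≡ M
    reachesM = φ-followsPath (φ-record rR R≢top next) between d (s≤s z≤n) ≤-refl

    M≡R : M ≡ R
    M≡R = Finₚ.≤-antisym M≤R R≤M
      where
      M≤R : M ≤ᶠ R
      M≤R = subst (_≤ᶠ R) (sym (iter-sucʳ p j R′)) (nextRecord-parentBelow next j)
      ret = Periodic.return φ ℓ≥1 per d
      R≤M : R ≤ᶠ M
      R≤M = subst (_≤ᶠ M) (trans (cong (iter φ (proj₁ ret)) (sym reachesM)) (proj₂ ret))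
              (PathBelow-iterφ M-dominates (proj₁ ret) 0)

    drc : DRC p R R′
    drc = let rR′ , R<R′ , least = next in
      rR , rR′ , ((λ R≡R′ → Finₚ.<⇒≢ R<R′ R≡R′) , d , M≡R) , R<R′ ,
      λ R″ rR″ (R<R″ , R″<R′) → <⇒≱ R″<R′ (least R″ rR″ R<R″)

  cycle⇒covering : ∀ {x ℓ} → 1 ≤ ℓ → iter φ ℓ x ≡ x → x ≢ fzero → x ≢ top →
                   ∃ λ j → ∃ λ R′ → ∃ λ d →
                     DRC p (iter φ j x) R′ × IsAncestorDistance p (iter φ j x) R′ d
  cycle⇒covering {x} ℓ≥1 per x≢0 x≢top with recordOnCycle ℓ≥1 per x≢0
  ... | j , rR = j , periodicRecord⇒covering rR R≢top ℓ≥1 (Periodic.period-iter φ ℓ≥1 per j)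
    where
    R≢top : iter φ j x ≢ top
    R≢top atTop = x≢top (Periodic.reaches-fixed φ ℓ≥1 per j φ-top atTop)

  CycleEntry : Fin (suc n) × ℕ → Set
  CycleEntry (x , ℓ) = IsCycleRep φ x × x ≢ fzero × x ≢ top × IsCycleLength φ x ℓ

  CoveringEntry : (Fin (suc n) × Fin (suc n)) × ℕ → Set
  CoveringEntry ((R , R′) , d) = DRC p R R′ × IsAncestorDistance p R R′ d

  cycleCode : (Fin (suc n) × Fin (suc n)) × ℕ → Fin (suc n) × ℕ
  cycleCode ((R , _) , d) = cycleMin φ R d , d

  cycleCode-into : ∀ c → CoveringEntry c → CycleEntry (cycleCode c)
  cycleCode-into ((R , R′) , d) (drc , dist) =
    cycleMin-isCycleRep φ d≥1 per , min≢0 , min≢top , cycleLength-iter φ length i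
    where
    open CoveringCycle (covering⇒cycle d drc dist)
    d≥1 = proj₁ length
    per = proj₁ (proj₂ length)
    i = cycleMinIndex φ R d
    open Periodic φ d≥1 per using (reaches-fixed)
    min≢0 : cycleMin φ R d ≢ fzero
    min≢0 atRoot = proj₁ (proj₁ drc) (reaches-fixed i φ-root atRoot)
    min≢top : cycleMin φ R d ≢ top
    min≢top atTop = R≢top (reaches-fixed i φ-top atTop)

  cycleCode-onCycle : ∀ {x ℓ R′ d} j → IsCycleRep φ x → IsCycleLength φ x ℓ →
                      CoveringEntry ((iter φ j x , R′) , d) →
                      cycleCode ((iter φ j x , R′) , d) ≡ (x , ℓ)
  cycleCode-onCycle {x} {ℓ} {R′} {d} j rep lenₓ (drc , dist) = cong₂ _,_ (sym x≡min) d≡ℓ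
    where
    R = iter φ j x
    lenR = CoveringCycle.length (covering⇒cycle d drc dist)
    d≡ℓ = cycleLength-unique φ lenR (cycleLength-iter φ lenₓ j)
    x≡min : x ≡ cycleMin φ R d
    x≡min = cycleRep-unique φ (cycleMinIndex φ R d + j) rep
              (cycleMin-isCycleRep φ (proj₁ lenR) (proj₁ (proj₂ lenR)))
              (iter-+ φ (cycleMinIndex φ R d) j x)

  cycleCode-onto : ∀ a → CycleEntry a → ∃ λ c → CoveringEntry c × cycleCode c ≡ a
  cycleCode-onto (x , ℓ) (rep , x≢0 , x≢top , lenₓ@(ℓ≥1 , perₓ , _)) =
    let j , R′ , d , entry = cycle⇒covering ℓ≥1 perₓ x≢0 x≢top in
    ((iter φ j x , R′) , d) , entry , cycleCode-onCycle j rep lenₓ entry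

  cycleCode-injective : ∀ c c′ → CoveringEntry c → CoveringEntry c′ →
                        cycleCode c ≡ cycleCode c′ → c ≡ c′
  cycleCode-injective ((R , R′) , d) ((S , S′) , e) (drcR , distR) (drcS , distS) same
    with cong proj₂ same
  ... | refl = cong₂ _,_ (cong₂ _,_ R≡S R′≡S′) refl
    where
    module CR = CoveringCycle (covering⇒cycle d drcR distR)
    module CS = CoveringCycle (covering⇒cycle d drcS distS)
    S-return = cycleMin-return φ (proj₁ CS.length) (proj₁ (proj₂ CS.length))
    r = proj₁ S-return
    S-onCycleR : iter φ (r + cycleMinIndex φ R d) R ≡ S
    S-onCycleR = begin
      iter φ (r + cycleMinIndex φ R d) R  ≡⟨ iter-+ φ r _ R ⟩
      iter φ r (cycleMin φ R d)           ≡⟨ cong (iter φ r ∘ proj₁) same ⟩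
      iter φ r (cycleMin φ S d)           ≡⟨ proj₂ S-return ⟩
      S                                   ∎
    R≡S : R ≡ S
    R≡S = trans (sym (CR.onlyRecord (r + cycleMinIndex φ R d)
                        (subst (IsRecord p) (sym S-onCycleR) (proj₁ drcS))))
                S-onCycleR
    R′≡S′ : R′ ≡ S′
    R′≡S′ = nextRecord-unique CR.next (subst (λ z → SmallestRecordAbove p z S′) (sym R≡S) CS.next)

lemma3p3 : (n : ℕ) → 1 ≤ n →
    (p : Fin (suc n) → Fin (suc n)) → IsRootedTree n p →
    (φ : Fin (suc n) → Fin (suc n)) → IsPhi p φ →
    (cs : List (Fin (suc n) × ℕ)) →
    Enumerates cs (λ { (x , ℓ) → IsCycleRep φ x × x ≢ fzero × x ≢ fromℕ n × IsCycleLength φ x ℓ }) →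
    (ds : List ((Fin (suc n) × Fin (suc n)) × ℕ)) →
    Enumerates ds (λ { ((R , R′) , d) → DRC p R R′ × IsAncestorDistance p R R′ d }) →
    map proj₂ cs ↭ map proj₂ ds
lemma3p3 n n≥1 p tree φ isφ cs enumCs ds enumDs =
  ↭-trans (map⁺ proj₂ cs↭codes) (↭-reflexive (sym (map-∘ ds)))
  where
  open RecordCode n≥1 p tree φ isφ
  cs↭codes : cs ↭ map cycleCode ds
  cs↭codes = enumerations-↭ cycleCode cycleCode-into cycleCode-onto cycleCode-injective
                            enumCs enumDs
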